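{- Let $G$ be a simple graph on the vertex set $\{v_1,\dots,v_n\}$. If $G$ is twin-free, the lexicographic algorithm (described in the context) run on $G$ returns a set $C$ of indices such that $\{v_c : c\in C\}$ is an identifying code of $G$; if $G$ is not twin-free, it returns a failure (i.e. its output $C$ contains $n+1$).
   Context: For a vertex $v$, $N(v)=\{v\}\cup\{w: vw\in E(G)\}$ is its closed neighbourhood. A set $C$ of vertices is an identifying code if $N(v)\cap C\neq\emptyset$ for every vertex $v$ and $N(v)\cap C\neq N(w)\cap C$ for all distinct vertices $v,w$. $G$ is twin-free if there are no two distinct vertices $v,w$ with $N(v)=N(w)$. Vertices are identified with their indices. Let ${\bf B}={\bf I}_n+{\bf A}$ (${\bf A}$ the adjacency matrix), so ${\bf B}(i,l)=1$ iff $v_i\in N(v_l)$. Let $\mathtt{min1}(j)$ be the smallest index $i$ with $v_i\in N(v_j)$. Let $\mathtt{min2}(j,k)$ be the smallest $l\in\{1,\dots,n\}$ with ${\bf B}(j,l)\neq{\bf B}(k,l)$, or $n+1$ if no such $l$ exists. The lexicographic algorithm: initialise $C\gets\emptyset$, ${\bf X}\gets$ the $n\times n$ zero matrix, $j\gets 1$. While $j\le n$ and $n+1\notin C$: set $l\gets 0$; if row $j$ of ${\bf X}$ is zero, set $l\gets\mathtt{min1}(j)$; otherwise set $k\gets 1$ and, while row $j$ of ${\bf X}$ differs from row $k$ of ${\bf X}$ and $k<j$, increment $k$; then if $k<j$, set $l\gets\mathtt{min2}(j,k)$. If $l\ge 1$, add $l$ to $C$, and if moreover $l\le n$, replace column $l$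 of ${\bf X}$ by column $l$ of ${\bf B}$. Then increment $j$. Finally return $C$. -}

module Defs where

open import Data.Bool using (Bool; true; false; _∧_; _∨_; not; if_then_else_)
open import Data.Nat using (ℕ; zero; suc)
open import Data.Fin using (Fin; zero; suc; toℕ; fromℕ; inject₁; _≟_)
open import Data.Fin.Properties using () renaming (_≟_ to _≟F_)
open import Data.List using (List; []; _∷_; foldl)
open import Data.Bool.ListAction using (any)
open import Data.List.Membership.Propositional using (_∈_)
open import Data.Maybe using (Maybe; just; nothing; maybe)
open import Data.Product using (Σ; _×_; _,_; ∃)
open import Data.Sum using (_⊎_)
open import Relation.Binary.PropositionalEquality using (_≡_; _≢_)
open import Relation.Nullary using (¬_)
open import Relation.Nullary.Decidable using (⌊_⌋)
open import Function.Bundles using (_⇔_)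
import Data.Nat as ℕ
import Data.List as L

-- CONVENTIONS: vertices v_1..v_n are represented by Fin n = {0..n-1}
-- (vertex v_i is index i-1).  Algorithm outputs are indices in Fin (suc n);
-- the failure value "n+1" is represented by  fromℕ n  (the top element),
-- and a vertex index i : Fin n corresponds to  inject₁ i.

Adjacency : ℕ → Set
Adjacency n = Fin n → Fin n → Bool

IsSimple : ∀ {n} → Adjacency n → Set
IsSimple {n} A = (∀ (i j : Fin n) → A i j ≡ A j i) × (∀ (i : Fin n) → A i i ≡ false)

N : ∀ {n} → Adjacency n → Fin n → Fin n → Set
N A v u = (u ≡ v) ⊎ (A u v ≡ true)

TwinFree : ∀ {n} → Adjacency n → Set
TwinFree {n} A = ∀ (v w : Fin n) → v ≢ w → ¬ (∀ (u : Fin n) → N A v u ⇔ N A w u)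

IsIdentifyingCode : ∀ {n} → Adjacency n → (Fin n → Set) → Set
IsIdentifyingCode {n} A S =
  (∀ (v : Fin n) → ∃ λ u → N A v u × S u) ×
  (∀ (v w : Fin n) → v ≢ w → ¬ (∀ (u : Fin n) → (N A v u × S u) ⇔ (N A w u × S u)))

first : ∀ {n} → (Fin n → Bool) → Maybe (Fin n)
first {zero} f = nothing
first {suc n} f = if f zero then just zero else Data.Maybe.map suc (first (λ i → f (suc i)))
  where import Data.Maybe

orTop : ∀ {n} → Maybe (Fin n) → Fin (suc n)
orTop {n} = maybe inject₁ (fromℕ n)

_==_ : ∀ {n} → Fin n → Fin n → Bool
i == j = ⌊ i ≟F j ⌋

B : ∀ {n} → Adjacency n → Fin n → Fin n → Bool
B A i l = (i == l) ∨ A i l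

min1 : ∀ {n} → Adjacency n → Fin n → Fin (suc n)
min1 A j = orTop (first (λ i → B A i j))

xor : Bool → Bool → Bool
xor a b = if a then not b else b

min2 : ∀ {n} → Adjacency n → Fin n → Fin n → Fin (suc n)
min2 A j k = orTop (first (λ l → xor (B A j l) (B A k l)))

Matrix : ℕ → Set
Matrix n = Fin n → Fin n → Bool

allB : ∀ {n} → (Fin n → Bool) → Bool
allB {zero} f = true
allB {suc n} f = f zero ∧ allB (λ i → f (suc i))

rowZero : ∀ {n} → Matrix n → Fin n → Bool
rowZero X j = allB (λ l → not (X j l))

beq : Bool → Bool → Bool
beq a b = not (xor a b)

rowEq : ∀ {n} → Matrix n → Fin n → Fin n → Bool
rowEq X j k = allB (λ l → beq (X j l) (X k l))

_<ᵇF_ : ∀ {n} → Fin n → Fin n → Bool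
i <ᵇF j = toℕ i ℕ.<ᵇ toℕ j

-- The inner while-loop on k stops at the smallest k with row k = row j
-- (at worst k = j); "k < j" holds iff some earlier row equals row j,
-- and then k is the smallest such.
earlierEqualRow : ∀ {n} → Matrix n → Fin n → Maybe (Fin n)
earlierEqualRow X j = first (λ k → (k <ᵇF j) ∧ rowEq X j k)

-- value of l at step j (nothing  corresponds to  l = 0)
chooseL : ∀ {n} → Adjacency n → Matrix n → Fin n → Maybe (Fin (suc n))
chooseL A X j with rowZero X j
... | true = just (min1 A j)
... | false = maybe (λ k → just (min2 A j k)) nothing (earlierEqualRow X j)

-- l ≤ n  (i.e. l is a genuine vertex index): lower it to Fin n.
lower : ∀ {n} → Fin (suc n) → Maybe (Fin n)
lower {zero} _ = nothing
lower {suc n} zero = just zero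
lower {suc n} (suc i) = Data.Maybe.map suc (lower i)
  where import Data.Maybe

updateCol : ∀ {n} → Adjacency n → Matrix n → Fin n → Matrix n
updateCol A X l i m = if m == l then B A i l else X i m

State : ℕ → Set
State n = List (Fin (suc n)) × Matrix n

failed : ∀ {n} → List (Fin (suc n)) → Bool
failed {n} C = any (λ c → c == fromℕ n) C

-- one iteration of the outer loop (with the guard "n+1 ∉ C")
step : ∀ {n} → Adjacency n → State n → Fin n → State n
step A (C , X) j with failed C
... | true = (C , X)
... | false with chooseL A X j
...   | nothing = (C , X)
...   | just l = (l ∷ C , maybe (updateCol A X) X (lower l))

zeroMatrix : ∀ {n} → Matrix n
zeroMatrix _ _ = false

lexAlgorithm : ∀ {n} → Adjacency n → List (Fin (suc n))
lexAlgorithm {n} A =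
  Data.Product.proj₁ (foldl (step A) ([] , zeroMatrix) (L.allFin n))
  where import Data.Product

module Submission where

-- The matrix X maintained by the algorithm is B restricted to the chosen
-- columns: column l of X is column l of B if l ∈ C and zero otherwise
-- ('Represents C X').  Hence row v of X is the characteristic vector of
-- N(v) ∩ C, and C is an identifying code exactly when the rows of X are
-- nonzero and pairwise distinct.  The loop invariant ('Invariant') says:
-- after processing v_0 … v_{m-1}, either the algorithm has failed and G
-- has twins, or it has not failed, X represents C, and the first m rows
-- of X are nonzero and pairwise distinct ('Identifies m X').
--
-- Running the loop
-- yields the dichotomy 'lexAlgorithm-outcome', from which the theorem
-- follows because an identifying code can only exist in a twin-free graph.

open import Defs
open import Data.Bool using (Bool; true; false; _∧_; _∨_; not; if_then_else_)
open import Data.Bool.Properties using (∨-zeroʳ; not-injective; T-≡; T-∧)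
open import Data.Nat using (ℕ; zero; suc; _+_; _<_)
open import Data.Nat.Properties using (<ᵇ⇒<; <⇒<ᵇ; <-irrefl; m<1+n⇒m<n∨m≡n; +-identityʳ; +-suc)
open import Data.Fin using (Fin; zero; suc; toℕ; fromℕ; inject₁)
open import Data.Fin.Properties using (toℕ-injective; toℕ<n; fromℕ≢inject₁; inject₁-injective)
  renaming (_≟_ to _≟F_)
open import Data.List using (List; []; _∷_; foldl; tabulate; allFin)
open import Data.List.Relation.Unary.Any using (here; there)
open import Data.List.Membership.Propositional using (_∈_; _∉_)
open import Data.Maybe using (Maybe; just; nothing; maybe)
open import Data.Product using (_×_; _,_; ∃; proj₁; proj₂)
open import Data.Sum using (_⊎_; inj₁; inj₂; map₂)
open import Function.Bundles using (_⇔_; mk⇔; Equivalence)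
open import Function.Properties.Equivalence using () renaming (trans to ⇔-trans; sym to ⇔-sym)
open import Relation.Nullary using (¬_; yes; no; contradiction)
open import Relation.Nullary.Decidable using (toWitness)
open import Relation.Binary.PropositionalEquality
  using (_≡_; _≢_; refl; sym; trans; cong; cong₂)

==-sound : ∀ {n} {i j : Fin n} → (i == j) ≡ true → i ≡ j
==-sound e = toWitness (Equivalence.from T-≡ e)

==-refl : ∀ {n} (i : Fin n) → (i == i) ≡ true
==-refl i with i ≟F i
... | yes _ = refl
... | no i≢i = contradiction refl i≢i

==-sym : ∀ {n} (i j : Fin n) → (i == j) ≡ (j == i)
==-sym i j with i ≟F j
... | yes refl = sym (==-refl i)
... | no i≢j with j ≟F i
...   | yes j≡i = contradiction (sym j≡i) i≢j
...   | no _ = refl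

xor-false : ∀ {a b} → xor a b ≡ false → a ≡ b
xor-false {true} {true} _ = refl
xor-false {false} {false} _ = refl

xor-true : ∀ {a b} → xor a b ≡ true → a ≢ b
xor-true {true} {false} _ ()
xor-true {false} {true} _ ()

beq-true : ∀ {a b} → beq a b ≡ true → a ≡ b
beq-true {true} {true} _ = refl
beq-true {false} {false} _ = refl

beq-false : ∀ {a b} → beq a b ≡ false → a ≢ b
beq-false {true} {false} _ ()
beq-false {false} {true} _ ()

true-⇔⇒≡ : ∀ {a b} → (a ≡ true ⇔ b ≡ true) → a ≡ b
true-⇔⇒≡ {true} h = sym (Equivalence.to h refl)
true-⇔⇒≡ {false} {true} h with () ← Equivalence.from h refl
true-⇔⇒≡ {false} {false} _ = refl

first-sound : ∀ {n} (f : Fin n → Bool) {i} → first f ≡ just i → f i ≡ true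
first-sound {suc n} f e with f zero in f0
first-sound {suc n} f refl | true = f0
first-sound {suc n} f e | false with first (λ i → f (suc i)) in e′
first-sound {suc n} f refl | false | just _ = first-sound (λ i → f (suc i)) e′

first-none : ∀ {n} (f : Fin n → Bool) → first f ≡ nothing → ∀ i → f i ≡ false
first-none {suc n} f e i with f zero in f0
first-none {suc n} f () i | true
... | false with first (λ i → f (suc i)) in e′
first-none {suc n} f refl zero | false | nothing = f0
first-none {suc n} f refl (suc i) | false | nothing = first-none (λ i → f (suc i)) e′ i

allB-all : ∀ {n} (f : Fin n → Bool) → allB f ≡ true → ∀ i → f i ≡ true
allB-all {suc n} f e i with f zero in f0
allB-all {suc n} f e zero | true = f0
allB-all {suc n} f e (suc i) | true = allB-all (λ i → f (suc i)) e i

allB-witness : ∀ {n} (f : Fin n → Bool) → allB f ≡ false → ∃ λ i → f i ≡ false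
allB-witness {suc n} f e with f zero in f0
... | false = zero , f0
... | true with allB-witness (λ i → f (suc i)) e
...   | i , fi = suc i , fi

failed-∈ : ∀ {n} (C : List (Fin (suc n))) → failed C ≡ true → fromℕ n ∈ C
failed-∈ {n} (c ∷ C) e with c == fromℕ n in c≡top
... | true = here (sym (==-sound c≡top))
... | false = there (failed-∈ C e)

∈-failed : ∀ {n} (C : List (Fin (suc n))) → fromℕ n ∈ C → failed C ≡ true
∈-failed {n} (c ∷ C) (here refl) = cong (_∨ failed C) (==-refl (fromℕ n))
∈-failed {n} (c ∷ C) (there p) =
  trans (cong ((c == fromℕ n) ∨_) (∈-failed C p)) (∨-zeroʳ _)

lower-inject₁ : ∀ {n} (i : Fin n) → lower (inject₁ i) ≡ just i
lower-inject₁ {suc n} zero = refl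
lower-inject₁ {suc n} (suc i) rewrite lower-inject₁ i = refl

top-not-added : ∀ {n} {C : List (Fin (suc n))} (l : Fin n) →
  fromℕ n ∉ C → fromℕ n ∉ inject₁ l ∷ C
top-not-added l top∉C (here top≡l) = fromℕ≢inject₁ top≡l
top-not-added l top∉C (there top∈C) = top∉C top∈C

code⇒twin-free : ∀ {n} (A : Adjacency n) S → IsIdentifyingCode A S → TwinFree A
code⇒twin-free A S (_ , separates) v w v≢w twins =
  separates v w v≢w λ u →
    mk⇔ (λ (vu , Su) → Equivalence.to (twins u) vu , Su)
        (λ (wu , Su) → Equivalence.from (twins u) wu , Su)

module Algorithm {n : ℕ} (A : Adjacency n) (symA : ∀ i j → A i j ≡ A j i) where

  open import Data.List.Membership.DecPropositional (_≟F_ {suc n}) using (_∈?_)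

  B-sym : ∀ i j → B A i j ≡ B A j i
  B-sym i j = cong₂ _∨_ (==-sym i j) (symA i j)

  N⇔B : ∀ v u → N A v u ⇔ B A v u ≡ true
  N⇔B v u = mk⇔ to from
    where
    to : N A v u → B A v u ≡ true
    to (inj₁ refl) = cong (_∨ A v v) (==-refl v)
    to (inj₂ Auv) = trans (cong ((v == u) ∨_) (trans (symA v u) Auv)) (∨-zeroʳ _)
    from : B A v u ≡ true → N A v u
    from e with v == u in v≡u
    ... | true = inj₁ (sym (==-sound v≡u))
    ... | false = inj₂ (trans (symA u v) e)

  -- min1 never fails: v_j itself lies in N(v_j).
  min1-neighbour : ∀ j → ∃ λ l → min1 A j ≡ inject₁ l × B A j l ≡ true
  min1-neighbour j with first (λ i → B A i j) in found
  ... | just l = l , refl , trans (B-sym j l) (first-sound _ found)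
  ... | nothing with () ← trans (sym (Equivalence.to (N⇔B j j) (inj₁ refl)))
                                (first-none _ found j)

  min2-outcome : ∀ j k →
    (min2 A j k ≡ fromℕ n × (∀ u → N A j u ⇔ N A k u)) ⊎
    (∃ λ l → min2 A j k ≡ inject₁ l × B A j l ≢ B A k l)
  min2-outcome j k with first (λ l → xor (B A j l) (B A k l)) in found
  ... | just l = inj₂ (l , refl , xor-true (first-sound _ found))
  ... | nothing = inj₁ (refl , twins)
    where
    sameB : ∀ u → B A j u ≡ B A k u
    sameB u = xor-false (first-none _ found u)
    twins : ∀ u → N A j u ⇔ N A k u
    twins u = ⇔-trans (N⇔B j u)
                (⇔-trans (mk⇔ (trans (sym (sameB u))) (trans (sameB u))) (⇔-sym (N⇔B k u)))

  Dominated : Matrix n → Fin n → Set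
  Dominated X i = ∃ λ a → X i a ≡ true

  Separated : Matrix n → Fin n → Fin n → Set
  Separated X i i' = ∃ λ a → X i a ≢ X i' a

  separated-sym : ∀ {X i i'} → Separated X i i' → Separated X i' i
  separated-sym (a , d) = a , λ e → d (sym e)

  rowZero-zero : ∀ (X : Matrix n) j → rowZero X j ≡ true → ∀ a → X j a ≡ false
  rowZero-zero X j e a = not-injective (allB-all (λ l → not (X j l)) e a)

  rowZero-dominated : ∀ (X : Matrix n) j → rowZero X j ≡ false → Dominated X j
  rowZero-dominated X j e with allB-witness (λ l → not (X j l)) e
  ... | a , not-Xja = a , not-injective not-Xja

  earlier-equal-row : ∀ (X : Matrix n) j {k} → earlierEqualRow X j ≡ just k →
    toℕ k < toℕ j × (∀ a → X j a ≡ X k a)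
  earlier-equal-row X j {k} e
    with Equivalence.to T-∧ (Equivalence.from T-≡ (first-sound (λ k → (k <ᵇF j) ∧ rowEq X j k) e))
  ... | k<j , rows≡ =
    <ᵇ⇒< (toℕ k) (toℕ j) k<j ,
    λ a → beq-true (allB-all (λ l → beq (X j l) (X k l)) (Equivalence.to T-≡ rows≡) a)

  no-earlier-equal-row : ∀ (X : Matrix n) j → earlierEqualRow X j ≡ nothing →
    ∀ k → toℕ k < toℕ j → Separated X j k
  no-earlier-equal-row X j e k k<j
    with first-none (λ k → (k <ᵇF j) ∧ rowEq X j k) e k
  ... | rows≢ rewrite Equivalence.to T-≡ (<⇒<ᵇ k<j)
    with allB-witness (λ l → beq (X j l) (X k l)) rows≢
  ...   | a , d = a , beq-false d

  record Identifies (m : ℕ) (X : Matrix n) : Set where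
    field
      dominated : ∀ k → toℕ k < m → Dominated X k
      separated : ∀ k k' → toℕ k < m → toℕ k' < m → k ≢ k' → Separated X k k'

  identifies-none : ∀ X → Identifies 0 X
  identifies-none X = record { dominated = λ _ () ; separated = λ _ _ () }

  identifies-extend : ∀ {X} j → Identifies (toℕ j) X → Dominated X j →
    (∀ k → toℕ k < toℕ j → Separated X j k) → Identifies (suc (toℕ j)) X
  identifies-extend {X} j I dom sep = record { dominated = dominated′ ; separated = separated′ }
    where
    open Identifies I
    earlier-or-j : ∀ k → toℕ k < suc (toℕ j) → toℕ k < toℕ j ⊎ k ≡ j
    earlier-or-j k k≤j with m<1+n⇒m<n∨m≡n k≤j
    ... | inj₁ k<j = inj₁ k<j
    ... | inj₂ k≡j = inj₂ (toℕ-injective k≡j)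
    dominated′ : ∀ k → toℕ k < suc (toℕ j) → Dominated X k
    dominated′ k k≤j with earlier-or-j k k≤j
    ... | inj₁ k<j = dominated k k<j
    ... | inj₂ refl = dom
    separated′ : ∀ k k' → toℕ k < suc (toℕ j) → toℕ k' < suc (toℕ j) → k ≢ k' → Separated X k k'
    separated′ k k' k≤j k'≤j k≢k' with earlier-or-j k k≤j | earlier-or-j k' k'≤j
    ... | inj₁ k<j | inj₁ k'<j = separated k k' k<j k'<j k≢k'
    ... | inj₂ refl | inj₁ k'<j = sep k' k'<j
    ... | inj₁ k<j | inj₂ refl = separated-sym {X} (sep k k<j)
    ... | inj₂ refl | inj₂ refl = contradiction refl k≢k'

  record Represents (C : List (Fin (suc n))) (X : Matrix n) : Set where
    field
      chosen : ∀ l → inject₁ l ∈ C → ∀ i → X i l ≡ B A i l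
      unchosen : ∀ l → inject₁ l ∉ C → ∀ i → X i l ≡ false

  represents-empty : Represents [] zeroMatrix
  represents-empty = record { chosen = λ _ () ; unchosen = λ _ _ _ → refl }

  entry-meaning : ∀ {C X} → Represents C X → ∀ v a →
    X v a ≡ true ⇔ (N A v a × inject₁ a ∈ C)
  entry-meaning {C} {X} R v a = mk⇔ to from
    where
    open Represents R
    to : X v a ≡ true → N A v a × inject₁ a ∈ C
    to e with inject₁ a ∈? C
    ... | yes a∈C = Equivalence.from (N⇔B v a) (trans (sym (chosen a a∈C v)) e) , a∈C
    ... | no a∉C with () ← trans (sym e) (unchosen a a∉C v)
    from : N A v a × inject₁ a ∈ C → X v a ≡ true
    from (va , a∈C) = trans (chosen a a∈C v) (Equivalence.to (N⇔B v a) va)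

  -- Choosing l and copying column l of B into X preserves the
  -- representation; every other column is unchanged, and column l was
  -- zero before unless it was already chosen (and then it is unchanged
  -- too).  So an update never destroys a nonzero entry or a separation.
  module Update {C X} (R : Represents C X) (l : Fin n) where
    open Represents R

    X′ : Matrix n
    X′ = updateCol A X l

    updated-column : ∀ i → X′ i l ≡ B A i l
    updated-column i = cong (λ b → if b then B A i l else X i l) (==-refl l)

    represents-update : Represents (inject₁ l ∷ C) X′
    represents-update = record { chosen = chosen′ ; unchosen = unchosen′ }
      where
      chosen′ : ∀ a → inject₁ a ∈ inject₁ l ∷ C → ∀ i → X′ i a ≡ B A i a
      chosen′ a (here a≡l) i rewrite inject₁-injective a≡l = updated-column i
      chosen′ a (there a∈C) i with a == l in a==l
      ... | true = cong (B A i) (sym (==-sound a==l))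
      ... | false = chosen a a∈C i
      unchosen′ : ∀ a → inject₁ a ∉ inject₁ l ∷ C → ∀ i → X′ i a ≡ false
      unchosen′ a a∉ i with a == l in a==l
      ... | true = contradiction (here (cong inject₁ (==-sound a==l))) a∉
      ... | false = unchosen a (λ a∈C → a∉ (there a∈C)) i

    column-kept-or-empty : ∀ a → (∀ i → X′ i a ≡ X i a) ⊎ (∀ i → X i a ≡ false)
    column-kept-or-empty a with a == l in a==l
    ... | false = inj₁ (λ i → refl)
    ... | true with inject₁ a ∈? C
    ...   | yes a∈C = inj₁ (λ i → trans (cong (B A i) (sym (==-sound a==l))) (sym (chosen a a∈C i)))
    ...   | no a∉C = inj₂ (unchosen a a∉C)

    dominated-update : ∀ {i} → Dominated X i → Dominated X′ i
    dominated-update {i} (a , Xia) with column-kept-or-empty a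
    ... | inj₁ kept = a , trans (kept i) Xia
    ... | inj₂ empty with () ← trans (sym Xia) (empty i)

    separated-update : ∀ {i i'} → Separated X i i' → Separated X′ i i'
    separated-update {i} {i'} (a , d) with column-kept-or-empty a
    ... | inj₁ kept = a , λ e → d (trans (sym (kept i)) (trans e (kept i')))
    ... | inj₂ empty = contradiction (trans (empty i) (sym (empty i'))) d

    identifies-update : ∀ {m} → Identifies m X → Identifies m X′
    identifies-update I = record
      { dominated = λ k k<m → dominated-update (dominated k k<m)
      ; separated = λ k k' k<m k'<m k≢k' → separated-update (separated k k' k<m k'<m k≢k') }
      where open Identifies I

  open Update using (X′; updated-column; represents-update; dominated-update;
                     separated-update; identifies-update)

  identifies-new-row : ∀ {X} j → Identifies (toℕ j) X → rowZero X j ≡ false →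
    earlierEqualRow X j ≡ nothing → Identifies (suc (toℕ j)) X
  identifies-new-row {X} j I nonzero new =
    identifies-extend j I (rowZero-dominated X j nonzero) (no-earlier-equal-row X j new)

  -- Row j is zero: adding a neighbour l of v_j makes it nonzero, and the
  -- zero row was already separated from every (nonzero) earlier row.
  identifies-zero-row : ∀ {C X} (R : Represents C X) j l → Identifies (toℕ j) X →
    rowZero X j ≡ true → B A j l ≡ true → Identifies (suc (toℕ j)) (X′ R l)
  identifies-zero-row {X = X} R j l I row-zero Bjl =
    identifies-extend j (identifies-update R l I)
      (l , trans (updated-column R l j) Bjl)
      (λ k k<j → separated-update R l (separated-from-zero k k<j))
    where
    separated-from-zero : ∀ k → toℕ k < toℕ j → Separated X j k
    separated-from-zero k k<j with Identifies.dominated I k k<j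
    ... | a , Xka = a , λ Xja≡Xka →
      contradiction (trans (sym (rowZero-zero X j row-zero a)) (trans Xja≡Xka Xka)) λ ()

  -- Row j repeats an earlier row k: a column l where v_j and v_k differ
  -- separates them, and row j inherits nonzeroness and all separations
  -- from row k.
  identifies-repeated-row : ∀ {C X} (R : Represents C X) j {k} l → Identifies (toℕ j) X →
    earlierEqualRow X j ≡ just k → B A j l ≢ B A k l → Identifies (suc (toℕ j)) (X′ R l)
  identifies-repeated-row {X = X} R j {k} l I earlier Bj≢Bk =
    identifies-extend j (identifies-update R l I) (dominated-update R l dominated-j) separated-j
    where
    open Identifies I
    k<j : toℕ k < toℕ j
    k<j = proj₁ (earlier-equal-row X j earlier)
    same-row : ∀ a → X j a ≡ X k a
    same-row = proj₂ (earlier-equal-row X j earlier)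
    dominated-j : Dominated X j
    dominated-j with dominated k k<j
    ... | a , Xka = a , trans (same-row a) Xka
    separated-j : ∀ k' → toℕ k' < toℕ j → Separated (X′ R l) j k'
    separated-j k' k'<j with k' ≟F k
    ... | yes refl =
      l , λ e → Bj≢Bk (trans (sym (updated-column R l j)) (trans e (updated-column R l k')))
    ... | no k'≢k with separated k k' k<j k'<j (λ k≡k' → k'≢k (sym k≡k'))
    ...   | a , d = separated-update R l (a , λ e → d (trans (sym (same-row a)) e))

  Invariant : ℕ → State n → Set
  Invariant m s =
    (fromℕ n ∈ proj₁ s × ¬ TwinFree A) ⊎
    (fromℕ n ∉ proj₁ s × Represents (proj₁ s) (proj₂ s) × Identifies m (proj₂ s))

  data Choice (X : Matrix n) (j : Fin n) : Maybe (Fin (suc n)) → Set where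
    zero-row : rowZero X j ≡ true → Choice X j (just (min1 A j))
    new-row : rowZero X j ≡ false → earlierEqualRow X j ≡ nothing → Choice X j nothing
    repeated-row : ∀ {k} → rowZero X j ≡ false → earlierEqualRow X j ≡ just k →
                   Choice X j (just (min2 A j k))

  choice : ∀ X j → Choice X j (chooseL A X j)
  choice X j with rowZero X j in zero?
  ... | true = zero-row zero?
  ... | false with earlierEqualRow X j in earlier
  ...   | nothing = new-row zero? earlier
  ...   | just k = repeated-row zero? earlier

  add-vertex : ∀ {m C X} (R : Represents C X) l → fromℕ n ∉ C → Identifies m (X′ R l) →
    Invariant m (inject₁ l ∷ C , maybe (updateCol A X) X (lower (inject₁ l)))
  add-vertex R l top∉C I rewrite lower-inject₁ l =
    inj₂ (top-not-added l top∉C , represents-update R l , I)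

  -- One iteration preserves the invariant: a failed run is left unchanged;
  -- otherwise each branch extends the identified rows by row j, except
  -- when min2 fails, which happens only for a pair of twins.
  step-preserves : ∀ {m} j → toℕ j ≡ m → ∀ s → Invariant m s → Invariant (suc m) (step A s j)
  step-preserves j refl (C , X) (inj₁ (top∈C , has-twins)) rewrite ∈-failed C top∈C =
    inj₁ (top∈C , has-twins)
  step-preserves j refl (C , X) (inj₂ (top∉C , R , I)) with failed C in failure
  ... | true = contradiction (failed-∈ C failure) top∉C
  ... | false with chooseL A X j | choice X j
  ...   | nothing | new-row nonzero new = inj₂ (top∉C , R , identifies-new-row j I nonzero new)
  ...   | just _ | zero-row row-zero with min1-neighbour j
  ...     | l , min1≡l , Bjl rewrite min1≡l =
    add-vertex R l top∉C (identifies-zero-row R j l I row-zero Bjl)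
  step-preserves j refl (C , X) (inj₂ (top∉C , R , I)) | false | just _ | repeated-row {k} _ earlier
    with min2-outcome j k
  ... | inj₁ (min2≡top , twins) rewrite min2≡top =
    inj₁ (here refl , λ twin-free → twin-free j k j≢k twins)
    where
    j≢k : j ≢ k
    j≢k refl = <-irrefl refl (proj₁ (earlier-equal-row X j earlier))
  ... | inj₂ (l , min2≡l , Bj≢Bk) rewrite min2≡l =
    add-vertex R l top∉C (identifies-repeated-row R j l I earlier Bj≢Bk)

  run-preserves : ∀ {k} (f : Fin k → Fin n) m → (∀ i → toℕ (f i) ≡ m + toℕ i) →
    ∀ s → Invariant m s → Invariant (m + k) (foldl (step A) s (tabulate f))
  run-preserves {zero} f m _ s inv rewrite +-identityʳ m = inv
  run-preserves {suc k} f m consecutive s inv rewrite +-suc m k =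
    run-preserves (λ i → f (suc i)) (suc m)
      (λ i → trans (consecutive (suc i)) (+-suc m (toℕ i)))
      (step A s (f zero))
      (step-preserves (f zero) (trans (consecutive zero) (+-identityʳ m)) s inv)

  -- The loop visits v_0, …, v_{n-1} in order (allFin n = tabulate id).
  final-invariant : Invariant n (foldl (step A) ([] , zeroMatrix) (allFin n))
  final-invariant =
    run-preserves (λ i → i) 0 (λ _ → refl) _
      (inj₂ ((λ ()) , represents-empty , identifies-none zeroMatrix))

  identifying-code : ∀ {C X} → Represents C X → Identifies n X →
    IsIdentifyingCode A (λ i → inject₁ i ∈ C)
  identifying-code {C} {X} R I = dominating , separating
    where
    open Identifies I
    dominating : ∀ v → ∃ λ u → N A v u × inject₁ u ∈ C
    dominating v with dominated v (toℕ<n v)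
    ... | a , Xva = a , Equivalence.to (entry-meaning R v a) Xva
    separating : ∀ v w → v ≢ w →
      ¬ (∀ u → (N A v u × inject₁ u ∈ C) ⇔ (N A w u × inject₁ u ∈ C))
    separating v w v≢w same with separated v w (toℕ<n v) (toℕ<n w) v≢w
    ... | a , d = d (true-⇔⇒≡ (⇔-trans (entry-meaning R v a)
                                (⇔-trans (same a) (⇔-sym (entry-meaning R w a)))))

lexAlgorithm-outcome : ∀ {n} (A : Adjacency n) → IsSimple A →
  (fromℕ n ∈ lexAlgorithm A × ¬ TwinFree A) ⊎
  (fromℕ n ∉ lexAlgorithm A × IsIdentifyingCode A (λ i → inject₁ i ∈ lexAlgorithm A))
lexAlgorithm-outcome A (symA , _) =
  map₂ (λ (top∉C , R , I) → top∉C , identifying-code R I) final-invariant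
  where open Algorithm A symA

proposition1 : ∀ (n : ℕ) (A : Adjacency n) → IsSimple A →
    (TwinFree A →
      (¬ (fromℕ n ∈ lexAlgorithm A)) ×
      IsIdentifyingCode A (λ (i : Fin n) → inject₁ i ∈ lexAlgorithm A)) ×
    (¬ TwinFree A → fromℕ n ∈ lexAlgorithm A)
proposition1 n A simple with lexAlgorithm-outcome A simple
... | inj₁ (failure , has-twins) =
  (λ twin-free → contradiction twin-free has-twins) , (λ _ → failure)
... | inj₂ (success , code) =
  (λ _ → success , code) , (λ has-twins → contradiction (code⇒twin-free A _ code) has-twins)
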